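{- Let $f$ be a Boolean network, $\mathcal{X}\subseteq\mathrm{var}(f)$ a set of perturbable variables, $\beta$ a phenotype of $f$, $\Delta=\bigcup_{v\in\mathcal{X}}\{v^k,v^o\}$ and $\Omega=\bigcup_{u\in\Delta}\{p_u,n_u\}$. Let $g$ be the Boolean network obtained from $f$ and $\mathcal{X}$ by the perturbation transformation. Then the number of perturbations $\sigma$ on $\mathcal{X}$ such that the perturbed network $f^\sigma$ has at least one fixed point satisfying $\beta$ equals the projected answer set count $|\{M\cap\Omega : M\text{ an answer set of }\mathrm{fASP}(g)\cup\mathrm{toASP}(\beta)\}|$.
   Context: A Boolean network (BN) $f$ has a finite variable set $\mathrm{var}(f)$ and for each $v$ a Boolean function $f_v$ given as a propositional formula over $\mathrm{var}(f)$. A fixed point is a state $s\in\{0,1\}^{\mathrm{var}(f)}$ with $f_v(s)=s_v$ for all $v$, identified with a sub-space (map $\mathrm{var}(f)\to\{0,1,\star\}$) taking no value $\star$. A phenotype $\beta$ is a conjunction of traits $(v\leftrightarrow e)$, $v\in\mathrm{var}(f)$, $e\in\{0,1,\star\}$; a sub-space $m$ satisfies $\beta$ if $m(v)=e$ for each trait. A perturbation on $\mathcal{X}$ is a map $\sigma:\mathcal{X}\to\{0,1,\star\}$; the perturbed BN $f^\sigma$ has $\mathrm{var}(f^\sigma)=\mathrm{var}(f)$, $f^\sigma_v=\sigma(v)$ (constant) if $v\in\mathcal{X}$ and $\sigma(v)\ne\star$, and $f^\sigma_v=f_v$ otherwise. Perturbation transformation: $g$ has variables $\mathrm{var}(f)\cup\Delta$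 (with $v^k,v^o$ fresh), $g_v=f_v$ for $v\in\mathrm{var}(f)\setminus\mathcal{X}$, and for $v\in\mathcal{X}$: $g_v=\neg v^k\wedge(v^o\vee f_v)$, $g_{v^k}=v^k$, $g_{v^o}=v^o\wedge\neg v^k$. Answer set programs: rules $a_1\vee\dots\vee a_k\leftarrow b_1,\dots,b_m,\mathit{not}\,c_1,\dots,\mathit{not}\,c_n$; $M$ satisfies $r$ if $(H(r)\cup B^-(r))\cap M\neq\emptyset$ or $B^+(r)\setminus M\neq\emptyset$; reduct $P^M=\{H(r)\leftarrow B^+(r): r\in P, M\cap B^-(r)=\emptyset\}$; $M$ is an answer set if it is a model of $P$ and no proper subset is a model of $P^M$. Constraints have empty head ($\bot\leftarrow\dots$). $\mathrm{fASP}(g)$: for each variable $v$ of $g$, atoms $p_v,n_v$, the rule $p_v\vee n_v\leftarrow\top$, the constraint $\bot\leftarrow p_v,n_v$, and rules $\gamma(v)\leftarrow\gamma(\Phi_v^+)$, $\gamma(\neg v)\leftarrow\gamma(\Phi_v^-)$ with $\Phi_v^+,\Phi_v^-$ negation normal forms of $g_v$, $\neg g_v$; $\gamma(v)=p_v$, $\gamma(\neg v)=n_v$, $\gamma$ of a conjunction is the rule body of the $\gamma$'s of the conjuncts, $\gamma(\alpha_1\vee\dots\vee\alpha_J)=\mathit{aux}_k$ a fresh atom with rules $\mathit{aux}_k\leftarrow\gamma(\alpha_j)$ for each $j$. $\mathrm{toASP}(\beta)$: for each trait $(v\leftrightarrow e)$ add $\bot\leftarrow\mathit{not}\,p_v$,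 $\bot\leftarrow n_v$ if $e=1$; $\bot\leftarrow p_v$, $\bot\leftarrow\mathit{not}\,n_v$ if $e=0$; $\bot\leftarrow\mathit{not}\,p_v$, $\bot\leftarrow\mathit{not}\,n_v$ if $e=\star$. -}

module Defs where

open import Data.Nat using (ℕ; zero; suc)
open import Data.Fin using (Fin; zero; suc; _≟_)
open import Data.Bool using (Bool; true; false; not; T; if_then_else_; _∧_; _∨_)
open import Data.List using (List; []; _∷_; _++_; map; allFin; length)
open import Data.Bool.ListAction using (any)
open import Data.List.Relation.Unary.All using (All)
open import Data.List.Relation.Unary.Any using (Any)
open import Data.List.Relation.Unary.Unique.Propositional using (Unique)
open import Data.List.Membership.Propositional using (_∈_)
open import Data.Maybe using (Maybe; just; nothing)
import Data.Maybe as Maybe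
open import Data.Vec using (Vec; lookup; tabulate)
open import Data.Product using (Σ; ∃; _×_; _,_; proj₁)
open import Data.Sum using (_⊎_)
open import Function using (_∘_)
open import Function.Bundles using (_⇔_)
open import Relation.Nullary using (¬_; yes; no)
open import Relation.Binary.PropositionalEquality using (_≡_)

data Tri : Set where
  𝟘 𝟙 ⋆ : Tri

ofBool : Bool → Tri
ofBool true  = 𝟙
ofBool false = 𝟘

-- Propositional formulas (n-ary conjunction / disjunction;
-- ⊤ = ⋀ [], ⊥ = ⋁ [])

data Form (V : Set) : Set where
  var : V → Form V
  ¬'  : Form V → Form V
  ⋀   : List (Form V) → Form V
  ⋁   : List (Form V) → Form V

mutual
  eval : {V : Set} → (V → Bool) → Form V → Bool
  eval s (var v) = s v
  eval s (¬' φ)  = not (eval s φ)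
  eval s (⋀ φs)  = evalAll s φs
  eval s (⋁ φs)  = evalAny s φs

  evalAll : {V : Set} → (V → Bool) → List (Form V) → Bool
  evalAll s []       = true
  evalAll s (φ ∷ φs) = eval s φ ∧ evalAll s φs

  evalAny : {V : Set} → (V → Bool) → List (Form V) → Bool
  evalAny s []       = false
  evalAny s (φ ∷ φs) = eval s φ ∨ evalAny s φs

mutual
  rename : {V W : Set} → (V → W) → Form V → Form W
  rename r (var v) = var (r v)
  rename r (¬' φ)  = ¬' (rename r φ)
  rename r (⋀ φs)  = ⋀ (renames r φs)
  rename r (⋁ φs)  = ⋁ (renames r φs)

  renames : {V W : Set} → (V → W) → List (Form V) → List (Form W)
  renames r []       = []
  renames r (φ ∷ φs) = rename r φ ∷ renames r φs

BN : Set → Set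
BN V = V → Form V

FixedPoint : {V : Set} → BN V → (V → Bool) → Set
FixedPoint f s = ∀ v → eval s (f v) ≡ s v

-- a phenotype: a list (conjunction) of traits (v ↔ e)
Phenotype : ℕ → Set
Phenotype n = List (Fin n × Tri)

SatPheno : {n : ℕ} → (Fin n → Bool) → Phenotype n → Set
SatPheno s β = All (λ t → Data.Product.proj₂ t ≡ ofBool (s (proj₁ t))) β

-- Perturbable variables: X = image of an injective map x : Fin m → Fin n.
-- A perturbation on X is σ : Vec Tri m (σ(x i) = lookup σ i).

preimage : {m n : ℕ} → (Fin m → Fin n) → Fin n → Maybe (Fin m)
preimage {zero}  x v = nothing
preimage {suc m} x v with x zero ≟ v
... | yes _ = just zero
... | no  _ = Maybe.map suc (preimage (x ∘ suc) v)

constForm : {V : Set} → Tri → Form V → Form V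
constForm 𝟘 φ = ⋁ []
constForm 𝟙 φ = ⋀ []
constForm ⋆ φ = φ

perturb : {m n : ℕ} → (Fin m → Fin n) → BN (Fin n) → Vec Tri m → BN (Fin n)
perturb x f σ v with preimage x v
... | nothing = f v
... | just i  = constForm (lookup σ i) (f v)

data GVar (n m : ℕ) : Set where
  orig : Fin n → GVar n m
  kv   : Fin m → GVar n m     -- v^k for v = x i
  ov   : Fin m → GVar n m     -- v^o for v = x i

allGVar : (n m : ℕ) → List (GVar n m)
allGVar n m = map orig (allFin n) ++ (map kv (allFin m) ++ map ov (allFin m))

transform : {m n : ℕ} → (Fin m → Fin n) → BN (Fin n) → BN (GVar n m)
transform x f (orig v) with preimage x v
... | nothing = rename orig (f v)
... | just i  = ⋀ (¬' (var (kv i)) ∷ ⋁ (var (ov i) ∷ rename orig (f v) ∷ []) ∷ [])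
transform x f (kv i) = var (kv i)
transform x f (ov i) = ⋀ (var (ov i) ∷ ¬' (var (kv i)) ∷ [])

data NNF (V : Set) : Set where
  lit  : Bool → V → NNF V          -- lit true v = v, lit false v = ¬ v
  all' : List (NNF V) → NNF V
  any' : List (NNF V) → NNF V

mutual
  -- nnf true φ is an NNF of φ, nnf false φ is an NNF of ¬ φ
  nnf : {V : Set} → Bool → Form V → NNF V
  nnf b     (var v) = lit b v
  nnf b     (¬' φ)  = nnf (not b) φ
  nnf true  (⋀ φs)  = all' (nnfs true φs)
  nnf false (⋀ φs)  = any' (nnfs false φs)
  nnf true  (⋁ φs)  = any' (nnfs true φs)
  nnf false (⋁ φs)  = all' (nnfs false φs)

  nnfs : {V : Set} → Bool → List (Form V) → List (NNF V)
  nnfs b []       = []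
  nnfs b (φ ∷ φs) = nnf b φ ∷ nnfs b φs

record Rule (A : Set) : Set where
  constructor _⇐_∣_
  field
    head : List A
    pos  : List A
    neg  : List A
open Rule public

Program : Set → Set
Program A = List (Rule A)

Interp : Set → Set
Interp A = A → Bool

SatRule : {A : Set} → Interp A → Rule A → Set
SatRule M r = Any (λ a → T (M a)) (head r ++ neg r) ⊎ Any (λ a → T (not (M a))) (pos r)

Model : {A : Set} → Interp A → Program A → Set
Model M P = All (SatRule M) P

reduct : {A : Set} → Interp A → Program A → Program A
reduct M [] = []
reduct M (r ∷ P) =
  if any M (neg r) then reduct M P else ((head r ⇐ pos r ∣ []) ∷ reduct M P)

ProperSubset : {A : Set} → Interp A → Interp A → Set
ProperSubset N M = (∀ a → T (N a) → T (M a)) × (∃ λ a → T (M a) × ¬ T (N a))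

AnswerSet : {A : Set} → Program A → Interp A → Set
AnswerSet P M = Model M P × (∀ N → ProperSubset N M → ¬ Model N (reduct M P))

data Atom (V : Set) : Set where
  pA   : V → Atom V
  nA   : V → Atom V
  auxA : ℕ → Atom V

-- γ with a counter for fresh auxiliary atoms:
-- returns (rule body, generated auxiliary rules, next free counter)
mutual
  γ : {V : Set} → NNF V → ℕ → List (Atom V) × Program (Atom V) × ℕ
  γ (lit true  v) c = (pA v ∷ []) , [] , c
  γ (lit false v) c = (nA v ∷ []) , [] , c
  γ (all' φs) c = γAnd φs c
  γ (any' φs) c with γOr c φs (suc c)
  ... | rs , c' = (auxA c ∷ []) , rs , c'

  γAnd : {V : Set} → List (NNF V) → ℕ → List (Atom V) × Program (Atom V) × ℕ
  γAnd [] c = [] , [] , c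
  γAnd (φ ∷ φs) c with γ φ c
  ... | b , rs , c1 with γAnd φs c1
  ... | b2 , rs2 , c2 = (b ++ b2) , (rs ++ rs2) , c2

  γOr : {V : Set} → ℕ → List (NNF V) → ℕ → Program (Atom V) × ℕ
  γOr k [] c = [] , c
  γOr k (φ ∷ φs) c with γ φ c
  ... | b , rs , c1 with γOr k φs c1
  ... | rs2 , c2 = (((auxA k ∷ []) ⇐ b ∣ []) ∷ (rs ++ rs2)) , c2

varRules : {V : Set} → BN V → V → ℕ → Program (Atom V) × ℕ
varRules g u c with γ (nnf true (g u)) c
... | b1 , rs1 , c1 with γ (nnf false (g u)) c1
... | b2 , rs2 , c2 =
  (((pA u ∷ nA u ∷ []) ⇐ [] ∣ [])
   ∷ ([] ⇐ (pA u ∷ nA u ∷ []) ∣ [])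
   ∷ ((pA u ∷ []) ⇐ b1 ∣ [])
   ∷ ((nA u ∷ []) ⇐ b2 ∣ [])
   ∷ (rs1 ++ rs2)) , c2

fASPfrom : {V : Set} → List V → BN V → ℕ → Program (Atom V) × ℕ
fASPfrom [] g c = [] , c
fASPfrom (u ∷ us) g c with varRules g u c
... | P1 , c1 with fASPfrom us g c1
... | P2 , c2 = (P1 ++ P2) , c2

-- fASP(g), given the list of all variables of g
fASP : {V : Set} → List V → BN V → Program (Atom V)
fASP vs g = proj₁ (fASPfrom vs g 0)

traitRules : {V : Set} → V → Tri → Program (Atom V)
traitRules v 𝟙 = ([] ⇐ [] ∣ (pA v ∷ [])) ∷ ([] ⇐ (nA v ∷ []) ∣ []) ∷ []
traitRules v 𝟘 = ([] ⇐ (pA v ∷ []) ∣ []) ∷ ([] ⇐ [] ∣ (nA v ∷ [])) ∷ []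
traitRules v ⋆ = ([] ⇐ [] ∣ (pA v ∷ [])) ∷ ([] ⇐ [] ∣ (nA v ∷ [])) ∷ []

toASP : {V : Set} → List (V × Tri) → Program (Atom V)
toASP [] = []
toASP ((v , e) ∷ β) = traitRules v e ++ toASP β

liftPheno : {n m : ℕ} → Phenotype n → List (GVar n m × Tri)
liftPheno [] = []
liftPheno ((v , e) ∷ β) = (orig v , e) ∷ liftPheno β

ASPprog : {n m : ℕ} → (Fin m → Fin n) → BN (Fin n) → Phenotype n → Program (Atom (GVar n m))
ASPprog {n} {m} x f β = fASP (allGVar n m) (transform x f) ++ toASP (liftPheno β)

-- a subset of Ω, recorded per index i of X as
-- (p_{v^k}, n_{v^k}, p_{v^o}, n_{v^o}) membership
OmegaSub : ℕ → Set
OmegaSub m = Vec (Bool × Bool × Bool × Bool) m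

projΩ : {n m : ℕ} → Interp (Atom (GVar n m)) → OmegaSub m
projΩ M = tabulate λ i → M (pA (kv i)) , M (nA (kv i)) , M (pA (ov i)) , M (nA (ov i))

Card : {A : Set} → (A → Set) → ℕ → Set
Card {A} P k = Σ (List A) λ L → Unique L × length L ≡ k × (∀ a → (a ∈ L) ⇔ P a)

module Submission where

-- An answer set M of fASP(g) ∪ toASP(β) is determined by the state t = M ∘ p: n_u is ¬ t u, and
-- each auxiliary atom holds iff the disjunction it abbreviates holds under t. The rules p_u ← γ(Φ⁺),
-- n_u ← γ(Φ⁻) make t a fixed point of g satisfying β; conversely this canonical encoding of such
-- a fixed point is a model, and it is minimal for the negation-free reduct because a model below
-- it agrees with it on every p_u, n_u and must then derive all of its auxiliary atoms.
-- A fixed point of g is a fixed point of f^σ together with the pairs (v^k, v^o) encoding σ, and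
-- these pairs are what the projection onto Ω retains. So both sets are images of the finite,
-- decidable set of perturbations admitting a fixed point that satisfies β, the second one under an
-- injective map, and have the same number of elements.

open import Defs
open import Data.Bool using (Bool; true; false; not; T; _∧_; _∨_)
open import Data.Bool.Properties
  using (not-involutive; ∨-identityʳ; ∧-identityʳ; T-∧; T-∨; ∨-∧-booleanAlgebra) renaming (_≟_ to _≟ᵇ_)
open import Algebra.Lattice.Properties.BooleanAlgebra ∨-∧-booleanAlgebra using (deMorgan₁; deMorgan₂)
import Data.Bool.ListAction as Bool
open import Data.Empty using (⊥; ⊥-elim)
open import Data.Fin using (Fin)
open import Data.Fin.Properties using (all?)
open import Data.List using (List; []; _∷_; _++_; map; length; filter; deduplicate; cartesianProductWith; allFin)
open import Data.List.Properties using (length-map)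
open import Data.List.Membership.Propositional using (_∈_; lose)
open import Data.List.Membership.Propositional.Properties
  using ( ∈-map⁺; ∈-map⁻; ∈-++⁺ˡ; ∈-++⁺ʳ; ∈-allFin; ∈-filter⁺; ∈-filter⁻; ∈-deduplicate⁺; ∈-deduplicate⁻
        ; ∈-cartesianProductWith⁺)
open import Data.List.Relation.Unary.All as All using (All; []; _∷_)
open import Data.List.Relation.Unary.All.Properties using (++⁺; ++⁻)
open import Data.List.Relation.Unary.Any as Any using (Any; here; there)
import Data.List.Relation.Unary.Unique.Propositional.Properties as Unique
open import Data.List.Relation.Unary.Unique.DecPropositional.Properties using (deduplicate-!)
open import Data.Maybe using (just; nothing)
open import Data.Nat using (ℕ; zero; suc; _≤_; _<_; _≡ᵇ_)
open import Data.Nat.Properties using (≤-refl; ≤-trans; <-≤-trans; n≤1+n; ≡ᵇ⇒≡; ≡⇒≡ᵇ; <⇒≱; ≤⇒≯)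
open import Data.Product using (∃; ∃-syntax; _×_; _,_; proj₁; proj₂)
open import Data.Sum using (_⊎_; inj₁; inj₂; [_,_])
open import Data.Vec using (Vec; []; _∷_; lookup; tabulate)
open import Data.Vec.Properties using (lookup∘tabulate; tabulate∘lookup; tabulate-cong; ≡-dec)
open import Function using (_∘_)
open import Function.Bundles using (_⇔_; mk⇔; Equivalence)
open import Function.Definitions using (Injective)
open import Relation.Nullary using (Dec; yes; no; ¬_)
open import Relation.Nullary.Decidable using (_×-dec_)
open import Relation.Unary using (Decidable)
open import Relation.Binary.Definitions using (DecidableEquality)
open import Relation.Binary.PropositionalEquality
  using (_≡_; _≗_; refl; sym; trans; cong; cong₂; subst; module ≡-Reasoning)

∧-elim : ∀ {a b} → T (a ∧ b) → T a × T b
∧-elim = Equivalence.to T-∧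

∧-intro : ∀ {a b} → T a → T b → T (a ∧ b)
∧-intro p q = Equivalence.from T-∧ (p , q)

∨-elim : ∀ {a b} → T (a ∨ b) → T a ⊎ T b
∨-elim = Equivalence.to T-∨

∨-introˡ : ∀ {a} b → T a → T (a ∨ b)
∨-introˡ b p = Equivalence.from T-∨ (inj₁ p)

∨-introʳ : ∀ a {b} → T b → T (a ∨ b)
∨-introʳ a q = Equivalence.from T-∨ (inj₂ q)

not-contradiction : ∀ {b} → T (not b) → T b → ⊥
not-contradiction {false} _ ()

≡-of-T-implications : ∀ {e x} → (T e → T x) → (T (not e) → T (not x)) → e ≡ x
≡-of-T-implications {false} {false} _ _ = refl
≡-of-T-implications {false} {true}  _ n = ⊥-elim (n _)
≡-of-T-implications {true}  {false} p _ = ⊥-elim (p _)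
≡-of-T-implications {true}  {true}  _ _ = refl

exactly-one : ∀ {p n} → T p ⊎ T n → (T p → T n → ⊥) → n ≡ not p
exactly-one {true}  {false} _ _ = refl
exactly-one {false} {true}  _ _ = refl
exactly-one {true}  {true}  _ c = ⊥-elim (c _ _)
exactly-one {false} {false} (inj₁ ()) _
exactly-one {false} {false} (inj₂ ()) _

cover-below⇒≡ : ∀ {np nn mp mn} → (T np → T mp) → (T nn → T mn) → T np ⊎ T nn → mn ≡ not mp → np ≡ mp × nn ≡ mn
cover-below⇒≡ {true}  {_}     {false} p _ _ _  = ⊥-elim (p _)
cover-below⇒≡ {_}     {true}  {_} {false} _ n _ _ = ⊥-elim (n _)
cover-below⇒≡ {false} {false} _ _ (inj₁ ()) _
cover-below⇒≡ {false} {false} _ _ (inj₂ ()) _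
cover-below⇒≡ {true}  {true}  {true}  {true} _ _ _ ()
cover-below⇒≡ {true}  {false} {true}  {true} _ _ _ ()
cover-below⇒≡ {true}  {false} {true}  {false} _ _ _ _ = refl , refl
cover-below⇒≡ {false} {true}  {true}  {true} _ _ _ ()
cover-below⇒≡ {false} {true}  {false} {true} _ _ _ _ = refl , refl

-- Valuations of auxiliary atoms supported on intervals of ℕ

_∪ᵇ_ : (ℕ → Bool) → (ℕ → Bool) → ℕ → Bool
(a ∪ᵇ b) j = a j ∨ b j

Supported : (ℕ → Bool) → ℕ → ℕ → Set
Supported a lo hi = ∀ j → T (a j) → lo ≤ j × j < hi

Agree : (ℕ → Bool) → (ℕ → Bool) → ℕ → ℕ → Set
Agree M a lo hi = ∀ j → lo ≤ j → j < hi → M j ≡ a j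

_⊆ᵇ_ : (ℕ → Bool) → (ℕ → Bool) → Set
a ⊆ᵇ b = ∀ j → T (a j) → T (b j)

unsupported⇒false : ∀ {a lo hi j} → Supported a lo hi → j < lo ⊎ hi ≤ j → a j ≡ false
unsupported⇒false {a} {j = j} sup out with a j | sup j
... | false | _     = refl
... | true  | range =
  ⊥-elim ([ (λ j<lo → <⇒≱ j<lo (proj₁ (range _))) , (λ hi≤j → ≤⇒≯ hi≤j (proj₂ (range _))) ] out)

module _ {a b : ℕ → Bool} {lo mid hi : ℕ} (lo≤mid : lo ≤ mid) (mid≤hi : mid ≤ hi)
         (sup-a : Supported a lo mid) (sup-b : Supported b mid hi) where

  supported-∪ᵇ : Supported (a ∪ᵇ b) lo hi
  supported-∪ᵇ j a∨b = [ (λ aj → let lo≤j , j<mid = sup-a j aj in lo≤j , <-≤-trans j<mid mid≤hi)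
                        , (λ bj → let mid≤j , j<hi = sup-b j bj in ≤-trans lo≤mid mid≤j , j<hi) ] (∨-elim a∨b)

  agree-∪ᵇ : ∀ {M} → Agree M (a ∪ᵇ b) lo hi → Agree M a lo mid × Agree M b mid hi
  agree-∪ᵇ agr = (λ j lo≤j j<mid → trans (agr j lo≤j (<-≤-trans j<mid mid≤hi))
                                         (trans (cong (a j ∨_) (unsupported⇒false sup-b (inj₁ j<mid))) (∨-identityʳ _)))
               , (λ j mid≤j j<hi → trans (agr j (≤-trans lo≤mid mid≤j) j<hi)
                                         (cong (_∨ b j) (unsupported⇒false sup-a (inj₂ mid≤j))))

∪ᵇ-⊆ᵇ : ∀ {a b m} → a ⊆ᵇ m → b ⊆ᵇ m → (a ∪ᵇ b) ⊆ᵇ m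
∪ᵇ-⊆ᵇ a⊆m b⊆m j p = [ a⊆m j , b⊆m j ] (∨-elim p)

point : ℕ → Bool → ℕ → Bool
point c e j = (j ≡ᵇ c) ∧ e

point-supported : ∀ c e → Supported (point c e) c (suc c)
point-supported c e j p with ≡ᵇ⇒≡ j c (proj₁ (∧-elim p))
... | refl = ≤-refl , ≤-refl

point-at : ∀ c e → point c e c ≡ e
point-at c e with c ≡ᵇ c | ≡⇒≡ᵇ c c refl
... | true | _ = refl

agree-point : ∀ {M c e} → Agree M (point c e) c (suc c) → M c ≡ e
agree-point {c = c} {e} agr = trans (agr c ≤-refl ≤-refl) (point-at c e)

point-⊆ᵇ : ∀ {c e m} → (T e → T (m c)) → point c e ⊆ᵇ m
point-⊆ᵇ {c} {e} h j p with ∧-elim {j ≡ᵇ c} p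
... | j≡c , te with ≡ᵇ⇒≡ j c j≡c
... | refl = h te

-- Formulas and negation normal form

mutual
  eval-rename : ∀ {V W : Set} (s : W → Bool) (r : V → W) φ → eval s (rename r φ) ≡ eval (s ∘ r) φ
  eval-rename s r (var v) = refl
  eval-rename s r (¬' φ)  = cong not (eval-rename s r φ)
  eval-rename s r (⋀ φs)  = proj₁ (eval-renames s r φs)
  eval-rename s r (⋁ φs)  = proj₂ (eval-renames s r φs)

  eval-renames : ∀ {V W : Set} (s : W → Bool) (r : V → W) φs →
                 evalAll s (renames r φs) ≡ evalAll (s ∘ r) φs × evalAny s (renames r φs) ≡ evalAny (s ∘ r) φs
  eval-renames s r []       = refl , refl
  eval-renames s r (φ ∷ φs) =
    let all≡ , any≡ = eval-renames s r φs in cong₂ _∧_ (eval-rename s r φ) all≡ , cong₂ _∨_ (eval-rename s r φ) any≡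

mutual
  eval-cong : ∀ {V : Set} {s s′ : V → Bool} → s ≗ s′ → ∀ φ → eval s φ ≡ eval s′ φ
  eval-cong s≗s′ (var v) = s≗s′ v
  eval-cong s≗s′ (¬' φ)  = cong not (eval-cong s≗s′ φ)
  eval-cong s≗s′ (⋀ φs)  = proj₁ (evals-cong s≗s′ φs)
  eval-cong s≗s′ (⋁ φs)  = proj₂ (evals-cong s≗s′ φs)

  evals-cong : ∀ {V : Set} {s s′ : V → Bool} → s ≗ s′ → ∀ φs →
               evalAll s φs ≡ evalAll s′ φs × evalAny s φs ≡ evalAny s′ φs
  evals-cong s≗s′ []       = refl , refl
  evals-cong s≗s′ (φ ∷ φs) =
    let all≡ , any≡ = evals-cong s≗s′ φs in cong₂ _∧_ (eval-cong s≗s′ φ) all≡ , cong₂ _∨_ (eval-cong s≗s′ φ) any≡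

polarity : Bool → Bool → Bool
polarity true  e = e
polarity false e = not e

polarity-not : ∀ b e → polarity (not b) e ≡ polarity b (not e)
polarity-not true  e = refl
polarity-not false e = sym (not-involutive e)

module _ {V : Set} where

  mutual
    evalⁿ : (V → Bool) → NNF V → Bool
    evalⁿ t (lit b v)  = polarity b (t v)
    evalⁿ t (all' φs) = evalⁿ-all t φs
    evalⁿ t (any' φs) = evalⁿ-any t φs

    evalⁿ-all : (V → Bool) → List (NNF V) → Bool
    evalⁿ-all t []       = true
    evalⁿ-all t (φ ∷ φs) = evalⁿ t φ ∧ evalⁿ-all t φs

    evalⁿ-any : (V → Bool) → List (NNF V) → Bool
    evalⁿ-any t []       = false
    evalⁿ-any t (φ ∷ φs) = evalⁿ t φ ∨ evalⁿ-any t φs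

  mutual
    eval-nnf : ∀ t b φ → evalⁿ t (nnf b φ) ≡ polarity b (eval t φ)
    eval-nnf t b     (var v) = refl
    eval-nnf t b     (¬' φ)  = trans (eval-nnf t (not b) φ) (polarity-not b (eval t φ))
    eval-nnf t true  (⋀ φs)  = proj₁ (eval-nnfs t φs)
    eval-nnf t false (⋀ φs)  = proj₁ (proj₂ (proj₂ (eval-nnfs t φs)))
    eval-nnf t true  (⋁ φs)  = proj₁ (proj₂ (eval-nnfs t φs))
    eval-nnf t false (⋁ φs)  = proj₂ (proj₂ (proj₂ (eval-nnfs t φs)))

    eval-nnfs : ∀ t φs →
      (evalⁿ-all t (nnfs true φs) ≡ evalAll t φs) × (evalⁿ-any t (nnfs true φs) ≡ evalAny t φs) ×
      (evalⁿ-any t (nnfs false φs) ≡ not (evalAll t φs)) × (evalⁿ-all t (nnfs false φs) ≡ not (evalAny t φs))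
    eval-nnfs t []       = refl , refl , refl , refl
    eval-nnfs t (φ ∷ φs) =
      let all⁺ , any⁺ , any⁻ , all⁻ = eval-nnfs t φs in
        cong₂ _∧_ (eval-nnf t true φ) all⁺
      , cong₂ _∨_ (eval-nnf t true φ) any⁺
      , trans (cong₂ _∨_ (eval-nnf t false φ) any⁻) (sym (deMorgan₁ (eval t φ) (evalAll t φs)))
      , trans (cong₂ _∧_ (eval-nnf t false φ) all⁻) (sym (deMorgan₂ (eval t φ) (evalAny t φs)))

-- The translation γ of NNF formulas into rules

module _ {V : Set} where

  Holds : Interp (Atom V) → List (Atom V) → Set
  Holds M = All (T ∘ M)

  fire : ∀ {M a bs} → SatRule M ((a ∷ []) ⇐ bs ∣ []) → Holds M bs → T (M a)
  fire (inj₁ (here p)) _ = p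
  fire (inj₂ q) hs = ⊥-elim (refute q hs)
    where
    refute : ∀ {M : Interp (Atom V)} {bs} → Any (T ∘ not ∘ M) bs → Holds M bs → ⊥
    refute (here p) (q ∷ _) = not-contradiction p q
    refute (there p) (_ ∷ qs) = refute p qs

  satisfy-definite : ∀ M {a} bs → (Holds M bs → T (M a)) → SatRule M ((a ∷ []) ⇐ bs ∣ [])
  satisfy-definite M []       h = inj₁ (here (h []))
  satisfy-definite M (b ∷ bs) h with M b in eq
  ... | false = inj₂ (here (subst (T ∘ not) (sym eq) _))
  ... | true with satisfy-definite M bs (λ hs → h (subst T (sym eq) _ ∷ hs))
  ...   | inj₁ fired  = inj₁ fired
  ...   | inj₂ failed = inj₂ (there failed)

  body : NNF V → ℕ → List (Atom V)
  body φ c = proj₁ (γ φ c)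

  rules : NNF V → ℕ → Program (Atom V)
  rules φ c = proj₁ (proj₂ (γ φ c))

  next : NNF V → ℕ → ℕ
  next φ c = proj₂ (proj₂ (γ φ c))

  nextL : List (NNF V) → ℕ → ℕ
  nextL []       c = c
  nextL (φ ∷ φs) c = nextL φs (next φ c)

  γAnd-next : ∀ φs c → proj₂ (proj₂ (γAnd φs c)) ≡ nextL φs c
  γAnd-next []       c = refl
  γAnd-next (φ ∷ φs) c = γAnd-next φs (next φ c)

  γOr-next : ∀ k φs c → proj₂ (γOr k φs c) ≡ nextL φs c
  γOr-next k []       c = refl
  γOr-next k (φ ∷ φs) c = γOr-next k φs (next φ c)

  mutual
    next-mono : ∀ φ c → c ≤ next φ c
    next-mono (lit true  v) c = ≤-refl
    next-mono (lit false v) c = ≤-refl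
    next-mono (all' φs)     c = subst (c ≤_) (sym (γAnd-next φs c)) (nextL-mono φs c)
    next-mono (any' φs)     c = subst (c ≤_) (sym (γOr-next c φs (suc c))) (≤-trans (n≤1+n c) (nextL-mono φs (suc c)))

    nextL-mono : ∀ φs c → c ≤ nextL φs c
    nextL-mono []       c = ≤-refl
    nextL-mono (φ ∷ φs) c = ≤-trans (next-mono φ c) (nextL-mono φs (next φ c))

  -- auxVal t φ c j is the value under t of the disjunction that γ φ c abbreviates by auxA j.
  mutual
    auxVal : (V → Bool) → NNF V → ℕ → ℕ → Bool
    auxVal t (lit _ _) c j = false
    auxVal t (all' φs) c   = auxValL t φs c
    auxVal t (any' φs) c   = point c (evalⁿ-any t φs) ∪ᵇ auxValL t φs (suc c)

    auxValL : (V → Bool) → List (NNF V) → ℕ → ℕ → Bool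
    auxValL t []       c j = false
    auxValL t (φ ∷ φs) c   = auxVal t φ c ∪ᵇ auxValL t φs (next φ c)

  module _ (t : V → Bool) where
    mutual
      auxVal-supported : ∀ φ c → Supported (auxVal t φ c) c (next φ c)
      auxVal-supported (lit _ _) c j ()
      auxVal-supported (all' φs) c =
        subst (Supported _ c) (sym (γAnd-next φs c)) (auxValL-supported φs c)
      auxVal-supported (any' φs) c =
        subst (Supported _ c) (sym (γOr-next c φs (suc c)))
          (supported-∪ᵇ (n≤1+n c) (nextL-mono φs (suc c)) (point-supported c _) (auxValL-supported φs (suc c)))

      auxValL-supported : ∀ φs c → Supported (auxValL t φs c) c (nextL φs c)
      auxValL-supported []       c j ()
      auxValL-supported (φ ∷ φs) c =
        supported-∪ᵇ (next-mono φ c) (nextL-mono φs (next φ c)) (auxVal-supported φ c) (auxValL-supported φs (next φ c))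

  Represents : (V → Bool) → Interp (Atom V) → Set
  Represents t M = ∀ u → M (pA u) ≡ t u × M (nA u) ≡ not (t u)

  module _ (t : V → Bool) (N : Interp (Atom V)) (rep : Represents t N) where
    mutual
      γ-sound : ∀ φ c → Model N (rules φ c) →
              (T (evalⁿ t φ) → Holds N (body φ c)) × auxVal t φ c ⊆ᵇ (N ∘ auxA)
      γ-sound (lit true  v) c _ = (λ p → subst T (sym (proj₁ (rep v))) p ∷ []) , λ _ ()
      γ-sound (lit false v) c _ = (λ p → subst T (sym (proj₂ (rep v))) p ∷ []) , λ _ ()
      γ-sound (all' φs)     c   = γAnd-sound φs c
      γ-sound (any' φs)     c m =
        let fires , aux⊆ = γOr-sound c φs (suc c) m in (λ p → fires p ∷ []) , ∪ᵇ-⊆ᵇ {point c _} (point-⊆ᵇ {c} fires) aux⊆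

      γAnd-sound : ∀ φs c → Model N (proj₁ (proj₂ (γAnd φs c))) →
                 (T (evalⁿ-all t φs) → Holds N (proj₁ (γAnd φs c))) × auxValL t φs c ⊆ᵇ (N ∘ auxA)
      γAnd-sound []       c _ = (λ _ → []) , λ _ ()
      γAnd-sound (φ ∷ φs) c m =
        let m₁ , m₂ = ++⁻ (rules φ c) m
            holds₁ , aux⊆₁ = γ-sound φ c m₁
            holds₂ , aux⊆₂ = γAnd-sound φs (next φ c) m₂
        in (λ p → let p₁ , p₂ = ∧-elim p in ++⁺ (holds₁ p₁) (holds₂ p₂)) , ∪ᵇ-⊆ᵇ {auxVal t φ c} aux⊆₁ aux⊆₂

      γOr-sound : ∀ k φs c → Model N (proj₁ (γOr k φs c)) →
                (T (evalⁿ-any t φs) → T (N (auxA k))) × auxValL t φs c ⊆ᵇ (N ∘ auxA)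
      γOr-sound k []       c _ = (λ ()) , λ _ ()
      γOr-sound k (φ ∷ φs) c (r ∷ m) =
        let m₁ , m₂ = ++⁻ (rules φ c) m
            holds₁ , aux⊆₁ = γ-sound φ c m₁
            fires₂ , aux⊆₂ = γOr-sound k φs (next φ c) m₂
        in [ fire r ∘ holds₁ , fires₂ ] ∘ ∨-elim , ∪ᵇ-⊆ᵇ {auxVal t φ c} aux⊆₁ aux⊆₂

  module _ (t : V → Bool) (M : Interp (Atom V)) (rep : Represents t M) where
    mutual
      γ-complete : ∀ φ c → Agree (M ∘ auxA) (auxVal t φ c) c (next φ c) →
                 (Holds M (body φ c) → T (evalⁿ t φ)) × Model M (rules φ c)
      γ-complete (lit true  v) c _ = (λ { (p ∷ []) → subst T (proj₁ (rep v)) p }) , []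
      γ-complete (lit false v) c _ = (λ { (p ∷ []) → subst T (proj₂ (rep v)) p }) , []
      γ-complete (all' φs)     c agr = γAnd-complete φs c (subst (Agree _ _ c) (γAnd-next φs c) agr)
      γ-complete (any' φs)     c agr =
        let agr₁ , agr₂ = agree-∪ᵇ (n≤1+n c) (nextL-mono φs (suc c)) (point-supported c _) (auxValL-supported t φs (suc c))
                                   (subst (Agree _ _ c) (γOr-next c φs (suc c)) agr)
            top = agree-point agr₁
        in (λ { (p ∷ []) → subst T top p }) , γOr-complete c φs (suc c) agr₂ (subst T (sym top))

      γAnd-complete : ∀ φs c → Agree (M ∘ auxA) (auxValL t φs c) c (nextL φs c) →
                    (Holds M (proj₁ (γAnd φs c)) → T (evalⁿ-all t φs)) × Model M (proj₁ (proj₂ (γAnd φs c)))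
      γAnd-complete []       c _ = (λ _ → _) , []
      γAnd-complete (φ ∷ φs) c agr =
        let agr₁ , agr₂ = agree-∷ φ φs c agr
            holds₁ , m₁ = γ-complete φ c agr₁
            holds₂ , m₂ = γAnd-complete φs (next φ c) agr₂
        in (λ p → let p₁ , p₂ = ++⁻ (body φ c) p in ∧-intro (holds₁ p₁) (holds₂ p₂)) , ++⁺ m₁ m₂

      γOr-complete : ∀ k φs c → Agree (M ∘ auxA) (auxValL t φs c) c (nextL φs c) →
                   (T (evalⁿ-any t φs) → T (M (auxA k))) → Model M (proj₁ (γOr k φs c))
      γOr-complete k []       c _ _ = []
      γOr-complete k (φ ∷ φs) c agr fires =
        let agr₁ , agr₂ = agree-∷ φ φs c agr
            holds₁ , m₁ = γ-complete φ c agr₁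
        in satisfy-definite M (body φ c) (fires ∘ ∨-introˡ (evalⁿ-any t φs) ∘ holds₁)
           ∷ ++⁺ m₁ (γOr-complete k φs (next φ c) agr₂ (fires ∘ ∨-introʳ (evalⁿ t φ)))

      agree-∷ : ∀ φ φs c → Agree (M ∘ auxA) (auxValL t (φ ∷ φs) c) c (nextL (φ ∷ φs) c) →
                Agree (M ∘ auxA) (auxVal t φ c) c (next φ c) ×
                Agree (M ∘ auxA) (auxValL t φs (next φ c)) (next φ c) (nextL φs (next φ c))
      agree-∷ φ φs c =
        agree-∪ᵇ (next-mono φ c) (nextL-mono φs (next φ c)) (auxVal-supported t φ c) (auxValL-supported t φs (next φ c))

  NegationFree : Program (Atom V) → Set
  NegationFree = All (λ r → neg r ≡ [])

  mutual
    rules-negationFree : ∀ φ c → NegationFree (rules φ c)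
    rules-negationFree (lit true  v) c = []
    rules-negationFree (lit false v) c = []
    rules-negationFree (all' φs)     c = rulesAnd-negationFree φs c
    rules-negationFree (any' φs)     c = rulesOr-negationFree c φs (suc c)

    rulesAnd-negationFree : ∀ φs c → NegationFree (proj₁ (proj₂ (γAnd φs c)))
    rulesAnd-negationFree []       c = []
    rulesAnd-negationFree (φ ∷ φs) c = ++⁺ (rules-negationFree φ c) (rulesAnd-negationFree φs (next φ c))

    rulesOr-negationFree : ∀ k φs c → NegationFree (proj₁ (γOr k φs c))
    rulesOr-negationFree k []       c = []
    rulesOr-negationFree k (φ ∷ φs) c = refl ∷ ++⁺ (rules-negationFree φ c) (rulesOr-negationFree k φs (next φ c))

-- Answer sets of fASP(g) ∪ toASP(β)

module _ {V : Set} where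

  Covers : Interp (Atom V) → V → Set
  Covers M u = T (M (pA u)) ⊎ T (M (nA u))

  Consistent : Interp (Atom V) → V → Set
  Consistent M u = T (M (pA u)) → T (M (nA u)) → ⊥

  module _ {t : V → Bool} {M : Interp (Atom V)} (rep : Represents t M) (u : V) where

    represents-covers : SatRule M ((pA u ∷ nA u ∷ []) ⇐ [] ∣ [])
    represents-covers with t u | rep u
    ... | true  | p , _ = inj₁ (here (subst T (sym p) _))
    ... | false | _ , n = inj₁ (there (here (subst T (sym n) _)))

    represents-consistent : SatRule M ([] ⇐ (pA u ∷ nA u ∷ []) ∣ [])
    represents-consistent with t u | rep u
    ... | true  | _ , n = inj₂ (there (here (subst (T ∘ not) (sym n) _)))
    ... | false | p , _ = inj₂ (here (subst (T ∘ not) (sym p) _))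

  represents-exclusive : ∀ {M : Interp (Atom V)} → (∀ u → Covers M u) → (∀ u → Consistent M u) → Represents (M ∘ pA) M
  represents-exclusive covers consistent u = refl , exactly-one (covers u) (consistent u)

  module _ (g : BN V) where

    φ⁺ φ⁻ : V → NNF V
    φ⁺ u = nnf true  (g u)
    φ⁻ u = nnf false (g u)

    varNext : V → ℕ → ℕ
    varNext u c = next (φ⁻ u) (next (φ⁺ u) c)

    varAux : (V → Bool) → V → ℕ → ℕ → Bool
    varAux t u c = auxVal t (φ⁺ u) c ∪ᵇ auxVal t (φ⁻ u) (next (φ⁺ u) c)

    progNext : List V → ℕ → ℕ
    progNext []       c = c
    progNext (u ∷ us) c = progNext us (varNext u c)

    progAux : (V → Bool) → List V → ℕ → ℕ → Bool
    progAux t []       c j = false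
    progAux t (u ∷ us) c   = varAux t u c ∪ᵇ progAux t us (varNext u c)

    varNext-mono : ∀ u c → c ≤ varNext u c
    varNext-mono u c = ≤-trans (next-mono (φ⁺ u) c) (next-mono (φ⁻ u) _)

    progNext-mono : ∀ us c → c ≤ progNext us c
    progNext-mono []       c = ≤-refl
    progNext-mono (u ∷ us) c = ≤-trans (varNext-mono u c) (progNext-mono us _)

    varAux-supported : ∀ t u c → Supported (varAux t u c) c (varNext u c)
    varAux-supported t u c =
      supported-∪ᵇ (next-mono (φ⁺ u) c) (next-mono (φ⁻ u) _) (auxVal-supported t (φ⁺ u) c) (auxVal-supported t (φ⁻ u) _)

    progAux-supported : ∀ t us c → Supported (progAux t us c) c (progNext us c)
    progAux-supported t []       c j ()
    progAux-supported t (u ∷ us) c =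
      supported-∪ᵇ (varNext-mono u c) (progNext-mono us _) (varAux-supported t u c) (progAux-supported t us _)

    fASPfrom-exclusive : ∀ N us c → Model N (proj₁ (fASPfrom us g c)) → ∀ {u} → u ∈ us → Covers N u × Consistent N u
    fASPfrom-exclusive N (u ∷ us) c (r₁ ∷ r₂ ∷ _) (here refl) = covers r₁ , consistent r₂
      where
      covers : SatRule N ((pA u ∷ nA u ∷ []) ⇐ [] ∣ []) → Covers N u
      covers (inj₁ (here p))         = inj₁ p
      covers (inj₁ (there (here q))) = inj₂ q
      consistent : SatRule N ([] ⇐ (pA u ∷ nA u ∷ []) ∣ []) → Consistent N u
      consistent (inj₂ (here p))         q _ = not-contradiction p q
      consistent (inj₂ (there (here n))) _ q = not-contradiction n q
    fASPfrom-exclusive N (u ∷ us) c m (there u∈us) =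
      fASPfrom-exclusive N us (varNext u c) (proj₂ (++⁻ (proj₁ (varRules g u c)) m)) u∈us

    module _ (t : V → Bool) (N : Interp (Atom V)) (rep : Represents t N) where

      varRules-sound : ∀ u c → Model N (proj₁ (varRules g u c)) → eval t (g u) ≡ t u × varAux t u c ⊆ᵇ (N ∘ auxA)
      varRules-sound u c (_ ∷ _ ∷ r⁺ ∷ r⁻ ∷ m) =
        let m⁺ , m⁻ = ++⁻ (rules (φ⁺ u) c) m
            holds⁺ , aux⊆⁺ = γ-sound t N rep (φ⁺ u) c m⁺
            holds⁻ , aux⊆⁻ = γ-sound t N rep (φ⁻ u) _ m⁻
        in ≡-of-T-implications (subst T (proj₁ (rep u)) ∘ fire r⁺ ∘ holds⁺ ∘ subst T (sym (eval-nnf t true (g u))))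
                  (subst T (proj₂ (rep u)) ∘ fire r⁻ ∘ holds⁻ ∘ subst T (sym (eval-nnf t false (g u))))
           , ∪ᵇ-⊆ᵇ {auxVal t (φ⁺ u) c} aux⊆⁺ aux⊆⁻

      fASPfrom-sound : ∀ us c → Model N (proj₁ (fASPfrom us g c)) →
                       (∀ {u} → u ∈ us → eval t (g u) ≡ t u) × progAux t us c ⊆ᵇ (N ∘ auxA)
      fASPfrom-sound []       c _ = (λ ()) , λ _ ()
      fASPfrom-sound (u ∷ us) c m =
        let m₁ , m₂ = ++⁻ (proj₁ (varRules g u c)) m
            fixed₁ , aux⊆₁ = varRules-sound u c m₁
            fixed₂ , aux⊆₂ = fASPfrom-sound us (varNext u c) m₂
        in (λ { (here refl) → fixed₁ ; (there u∈us) → fixed₂ u∈us }) , ∪ᵇ-⊆ᵇ {varAux t u c} aux⊆₁ aux⊆₂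

    module _ (t : V → Bool) (M : Interp (Atom V)) (rep : Represents t M) where

      varRules-complete : ∀ u c → eval t (g u) ≡ t u → Agree (M ∘ auxA) (varAux t u c) c (varNext u c) →
                          Model M (proj₁ (varRules g u c))
      varRules-complete u c fixed agr =
        let agr⁺ , agr⁻ = agree-∪ᵇ (next-mono (φ⁺ u) c) (next-mono (φ⁻ u) _)
                                   (auxVal-supported t (φ⁺ u) c) (auxVal-supported t (φ⁻ u) _) agr
            holds⁺ , m⁺ = γ-complete t M rep (φ⁺ u) c agr⁺
            holds⁻ , m⁻ = γ-complete t M rep (φ⁻ u) _ agr⁻
        in represents-covers rep u ∷ represents-consistent rep u
           ∷ satisfy-definite M _
               (subst T (sym (proj₁ (rep u))) ∘ subst T fixed ∘ subst T (eval-nnf t true (g u)) ∘ holds⁺)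
           ∷ satisfy-definite M _
               (subst T (sym (proj₂ (rep u))) ∘ subst T (cong not fixed) ∘ subst T (eval-nnf t false (g u)) ∘ holds⁻)
           ∷ ++⁺ m⁺ m⁻

      fASPfrom-complete : ∀ us c → (∀ {u} → u ∈ us → eval t (g u) ≡ t u) →
                          Agree (M ∘ auxA) (progAux t us c) c (progNext us c) → Model M (proj₁ (fASPfrom us g c))
      fASPfrom-complete []       c _     _   = []
      fASPfrom-complete (u ∷ us) c fixed agr =
        let agr₁ , agr₂ = agree-∪ᵇ (varNext-mono u c) (progNext-mono us _) (varAux-supported t u c) (progAux-supported t us _) agr
        in ++⁺ (varRules-complete u c (fixed (here refl)) agr₁) (fASPfrom-complete us (varNext u c) (fixed ∘ there) agr₂)

    varRules-negationFree : ∀ u c → NegationFree (proj₁ (varRules g u c))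
    varRules-negationFree u c = refl ∷ refl ∷ refl ∷ refl ∷ ++⁺ (rules-negationFree (φ⁺ u) c) (rules-negationFree (φ⁻ u) _)

    fASPfrom-negationFree : ∀ us c → NegationFree (proj₁ (fASPfrom us g c))
    fASPfrom-negationFree []       c = []
    fASPfrom-negationFree (u ∷ us) c = ++⁺ (varRules-negationFree u c) (fASPfrom-negationFree us (varNext u c))

  Satisfies : (V → Bool) → List (V × Tri) → Set
  Satisfies s βl = All (λ t → proj₂ t ≡ ofBool (s (proj₁ t))) βl

  module _ {t : V → Bool} {M : Interp (Atom V)} (rep : Represents t M) where

    traitRules-sound : ∀ v e → Model M (traitRules v e) → e ≡ ofBool (t v)
    traitRules-sound v 𝟙 (inj₁ (here p) ∷ _) with t v | rep v
    ... | true  | _      = refl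
    ... | false | p≡ , _ = ⊥-elim (subst T p≡ p)
    traitRules-sound v 𝟘 (inj₂ (here p) ∷ _) with t v | rep v
    ... | false | _      = refl
    ... | true  | p≡ , _ = ⊥-elim (subst (T ∘ not) p≡ p)
    traitRules-sound v ⋆ (inj₁ (here p) ∷ inj₁ (here n) ∷ []) =
      ⊥-elim (not-contradiction (subst T (proj₂ (rep v)) n) (subst T (proj₁ (rep v)) p))

    traitRules-complete : ∀ v e → e ≡ ofBool (t v) → Model M (traitRules v e)
    traitRules-complete v e e≡ with t v | rep v
    traitRules-complete v .𝟙 refl | true  | p , n =
      inj₁ (here (subst T (sym p) _)) ∷ inj₂ (here (subst (T ∘ not) (sym n) _)) ∷ []
    traitRules-complete v .𝟘 refl | false | p , n =
      inj₂ (here (subst (T ∘ not) (sym p) _)) ∷ inj₁ (here (subst T (sym n) _)) ∷ []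

    toASP-sound : ∀ βl → Model M (toASP βl) → Satisfies t βl
    toASP-sound []            _ = []
    toASP-sound ((v , e) ∷ βl) m =
      let m₁ , m₂ = ++⁻ (traitRules v e) m in traitRules-sound v e m₁ ∷ toASP-sound βl m₂

    toASP-complete : ∀ βl → Satisfies t βl → Model M (toASP βl)
    toASP-complete []             []         = []
    toASP-complete ((v , e) ∷ βl) (e≡ ∷ sat) = ++⁺ (traitRules-complete v e e≡) (toASP-complete βl sat)

    represents-⊆ : ∀ {N} → (∀ a → T (N a) → T (M a)) → ∀ u → Covers N u → N (pA u) ≡ t u × N (nA u) ≡ not (t u)
    represents-⊆ N⊆M u covers =
      let p≡ , n≡ = cover-below⇒≡ (N⊆M (pA u)) (N⊆M (nA u)) covers (trans (proj₂ (rep u)) (cong not (sym (proj₁ (rep u)))))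
      in trans p≡ (proj₁ (rep u)) , trans n≡ (proj₂ (rep u))

  reduct-++ : ∀ (M : Interp (Atom V)) P Q → reduct M (P ++ Q) ≡ reduct M P ++ reduct M Q
  reduct-++ M []      Q = refl
  reduct-++ M (r ∷ P) Q with Bool.any M (neg r)
  ... | true  = reduct-++ M P Q
  ... | false = cong (_ ∷_) (reduct-++ M P Q)

  reduct-negationFree : ∀ (M : Interp (Atom V)) P → NegationFree P → reduct M P ≡ P
  reduct-negationFree M []                    _          = refl
  reduct-negationFree M ((h ⇐ b ∣ .[]) ∷ P) (refl ∷ nf) = cong (_ ∷_) (reduct-negationFree M P nf)

  module AnswerSets (g : BN V) (us : List V) (all-vars : ∀ u → u ∈ us) (βl : List (V × Tri)) where

    program : Program (Atom V)
    program = fASP us g ++ toASP βl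

    answerSet⇒ : ∀ {M} → AnswerSet program M → FixedPoint g (M ∘ pA) × Satisfies (M ∘ pA) βl × Represents (M ∘ pA) M
    answerSet⇒ {M} (model , _) =
      (λ u → proj₁ (fASPfrom-sound g _ M rep us 0 m₁) (all-vars u)) , toASP-sound rep βl m₂ , rep
      where
      m₁ = proj₁ (++⁻ (fASP us g) model)
      m₂ = proj₂ (++⁻ (fASP us g) model)
      rep : Represents (M ∘ pA) M
      rep = represents-exclusive {M} (λ u → proj₁ (fASPfrom-exclusive g M us 0 m₁ (all-vars u)))
                                 (λ u → proj₂ (fASPfrom-exclusive g M us 0 m₁ (all-vars u)))

    canonical : (V → Bool) → Interp (Atom V)
    canonical t (pA u)   = t u
    canonical t (nA u)   = not (t u)
    canonical t (auxA j) = progAux g t us 0 j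

    canonical-represents : ∀ t → Represents t (canonical t)
    canonical-represents t u = refl , refl

    canonical-answerSet : ∀ {t} → FixedPoint g t → Satisfies t βl → AnswerSet program (canonical t)
    canonical-answerSet {t} fixed sat =
      ++⁺ (fASPfrom-complete g t _ rep us 0 (λ {u} _ → fixed u) (λ _ _ _ → refl)) (toASP-complete rep βl sat) , minimal
      where
      rep = canonical-represents t

      minimal : ∀ N → ProperSubset N (canonical t) → ¬ Model N (reduct (canonical t) program)
      minimal N (N⊆M , a , Ma , ¬Na) model = ¬Na (canonical⊆N a Ma)
        where
        m₁ : Model N (fASP us g)
        m₁ = subst (Model N) (reduct-negationFree _ _ (fASPfrom-negationFree g us 0))
               (proj₁ (++⁻ (reduct (canonical t) (fASP us g)) (subst (Model N) (reduct-++ _ (fASP us g) _) model)))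
        repN : Represents t N
        repN u = represents-⊆ rep N⊆M u (proj₁ (fASPfrom-exclusive g N us 0 m₁ (all-vars u)))
        canonical⊆N : ∀ a → T (canonical t a) → T (N a)
        canonical⊆N (pA u)   = subst T (sym (proj₁ (repN u)))
        canonical⊆N (nA u)   = subst T (sym (proj₂ (repN u)))
        canonical⊆N (auxA j) = proj₂ (fASPfrom-sound g t N repN us 0 m₁) j

-- Counting through finite enumerations

module _ {A : Set} where

  card-of-enumeration : {P : A → Set} (xs : List A) → (∀ a → a ∈ xs) → DecidableEquality A → Decidable P → ∃[ k ] Card P k
  card-of-enumeration xs complete _≟_ P? =
    length L , L , deduplicate-! _≟_ (filter P? xs) , refl ,
    λ a → mk⇔ (proj₂ ∘ ∈-filter⁻ P? {xs = xs} ∘ ∈-deduplicate⁻ _≟_ (filter P? xs))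
              (∈-deduplicate⁺ _≟_ ∘ ∈-filter⁺ P? (complete a))
    where
    L = deduplicate _≟_ (filter P? xs)

  card-image : ∀ {B : Set} {P : A → Set} {Q : B → Set} {k} (h : A → B) → Injective _≡_ _≡_ h →
               (∀ b → Q b ⇔ ∃ λ a → P a × b ≡ h a) → Card P k → Card Q k
  card-image h h-inj Q⇔ (L , unique , refl , ∈⇔P) =
    map h L , Unique.map⁺ h-inj unique , length-map h L ,
    λ b → mk⇔ (λ b∈ → let a , a∈ , b≡ = ∈-map⁻ h b∈ in
                       Equivalence.from (Q⇔ b) (a , Equivalence.to (∈⇔P a) a∈ , b≡))
              (λ q → let a , p , b≡ = Equivalence.to (Q⇔ b) q in
                     subst (_∈ map h L) (sym b≡) (∈-map⁺ h (Equivalence.from (∈⇔P a) p)))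

  vectors : List A → (k : ℕ) → List (Vec A k)
  vectors xs zero    = [] ∷ []
  vectors xs (suc k) = cartesianProductWith _∷_ xs (vectors xs k)

  ∈-vectors : ∀ {xs} → (∀ a → a ∈ xs) → ∀ {k} (w : Vec A k) → w ∈ vectors xs k
  ∈-vectors complete []      = here refl
  ∈-vectors complete (a ∷ w) = ∈-cartesianProductWith⁺ _∷_ (complete a) (∈-vectors complete w)

∈-bools : ∀ b → b ∈ true ∷ false ∷ []
∈-bools true  = here refl
∈-bools false = there (here refl)

∈-tris : ∀ a → a ∈ 𝟘 ∷ 𝟙 ∷ ⋆ ∷ []
∈-tris 𝟘 = here refl
∈-tris 𝟙 = there (here refl)
∈-tris ⋆ = there (there (here refl))

_≟ᵗ_ : DecidableEquality Tri
𝟘 ≟ᵗ 𝟘 = yes refl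
𝟙 ≟ᵗ 𝟙 = yes refl
⋆ ≟ᵗ ⋆ = yes refl
𝟘 ≟ᵗ 𝟙 = no λ ()
𝟘 ≟ᵗ ⋆ = no λ ()
𝟙 ≟ᵗ 𝟘 = no λ ()
𝟙 ≟ᵗ ⋆ = no λ ()
⋆ ≟ᵗ 𝟘 = no λ ()
⋆ ≟ᵗ 𝟙 = no λ ()

∃-state? : ∀ {n} {P : (Fin n → Bool) → Set} → (∀ {s s′} → s ≗ s′ → P s → P s′) → Decidable P → Dec (∃ P)
∃-state? {n} resp P? with Any.any? (P? ∘ lookup) (vectors (true ∷ false ∷ []) n)
... | yes found = let w , p = Any.satisfied found in yes (lookup w , p)
... | no ¬found = no λ (s , p) → ¬found (lose (∈-vectors ∈-bools (tabulate s)) (resp (sym ∘ lookup∘tabulate s) p))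

fixedPoint? : ∀ {n} (f : BN (Fin n)) s → Dec (FixedPoint f s)
fixedPoint? f s = all? λ v → eval s (f v) ≟ᵇ s v

fixedPoint-cong : ∀ {n} (f : BN (Fin n)) {s s′} → s ≗ s′ → FixedPoint f s → FixedPoint f s′
fixedPoint-cong f s≗s′ fixed v = trans (sym (eval-cong s≗s′ (f v))) (trans (fixed v) (s≗s′ v))

satPheno? : ∀ {n} s (β : Phenotype n) → Dec (SatPheno s β)
satPheno? s = All.all? λ t → proj₂ t ≟ᵗ ofBool (s (proj₁ t))

satPheno-cong : ∀ {n} (β : Phenotype n) {s s′} → s ≗ s′ → SatPheno s β → SatPheno s′ β
satPheno-cong β s≗s′ = All.map λ {t} e → trans e (cong ofBool (s≗s′ (proj₁ t)))

-- The perturbation transformation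

clamp : Tri → Bool → Bool
clamp 𝟘 _ = false
clamp 𝟙 _ = true
clamp ⋆ e = e

eval-constForm : ∀ {V : Set} (s : V → Bool) a φ → eval s (constForm a φ) ≡ clamp a (eval s φ)
eval-constForm s 𝟘 φ = refl
eval-constForm s 𝟙 φ = refl
eval-constForm s ⋆ φ = refl

-- g_v = ¬v^k ∧ (v^o ∨ f_v) clamps v to 0 when v^k holds and to 1 when only v^o holds, and the
-- fixed-point equation v^o = v^o ∧ ¬v^k rules out v^k = v^o = 1: the three remaining pairs
-- (v^k, v^o) are the three values of σ(v).
encode : Tri → Bool × Bool
encode 𝟘 = true  , false
encode 𝟙 = false , true
encode ⋆ = false , false

decode : Bool → Bool → Tri
decode true  _     = 𝟘
decode false true  = 𝟙
decode false false = ⋆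

decode-encode : ∀ a → decode (proj₁ (encode a)) (proj₂ (encode a)) ≡ a
decode-encode 𝟘 = refl
decode-encode 𝟙 = refl
decode-encode ⋆ = refl

encode-decode : ∀ k o → o ∧ (not k ∧ true) ≡ o → encode (decode k o) ≡ (k , o)
encode-decode true  false _ = refl
encode-decode false true  _ = refl
encode-decode false false _ = refl

encode-stable : ∀ a → proj₂ (encode a) ∧ (not (proj₁ (encode a)) ∧ true) ≡ proj₂ (encode a)
encode-stable 𝟘 = refl
encode-stable 𝟙 = refl
encode-stable ⋆ = refl

gate : ∀ k o e → not k ∧ (o ∨ e) ≡ clamp (decode k o) e
gate true  o     e = refl
gate false true  e = refl
gate false false e = refl

quad : Tri → Bool × Bool × Bool × Bool
quad a = proj₁ (encode a) , not (proj₁ (encode a)) , proj₂ (encode a) , not (proj₂ (encode a))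

quad-injective : Injective _≡_ _≡_ quad
quad-injective {a} {b} q≡ = begin
  a                                               ≡⟨ decode-encode a ⟨
  decode (proj₁ (encode a)) (proj₂ (encode a))    ≡⟨ cong (λ (k , _ , o , _) → decode k o) q≡ ⟩
  decode (proj₁ (encode b)) (proj₂ (encode b))    ≡⟨ decode-encode b ⟩
  b                                               ∎
  where open ≡-Reasoning

module Perturbation {n m : ℕ} (x : Fin m → Fin n) (f : BN (Fin n)) where

  g : BN (GVar n m)
  g = transform x f

  Decodes : (GVar n m → Bool) → Vec Tri m → Set
  Decodes τ σ = ∀ i → lookup σ i ≡ decode (τ (kv i)) (τ (ov i))

  eval-transform : ∀ {τ σ} → Decodes τ σ → ∀ v → eval τ (g (orig v)) ≡ eval (τ ∘ orig) (perturb x f σ v)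
  eval-transform {τ} {σ} dec v with preimage x v
  ... | nothing = eval-rename τ orig (f v)
  ... | just i  = begin
    not (τ (kv i)) ∧ ((τ (ov i) ∨ (eval τ (rename orig (f v)) ∨ false)) ∧ true)
      ≡⟨ cong (λ e → not (τ (kv i)) ∧ e) (trans (∧-identityʳ _) (cong (τ (ov i) ∨_) (∨-identityʳ _))) ⟩
    not (τ (kv i)) ∧ (τ (ov i) ∨ eval τ (rename orig (f v)))
      ≡⟨ gate (τ (kv i)) (τ (ov i)) _ ⟩
    clamp (decode (τ (kv i)) (τ (ov i))) (eval τ (rename orig (f v)))
      ≡⟨ cong₂ clamp (sym (dec i)) (eval-rename τ orig (f v)) ⟩
    clamp (lookup σ i) (eval (τ ∘ orig) (f v))
      ≡⟨ sym (eval-constForm (τ ∘ orig) (lookup σ i) (f v)) ⟩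
    eval (τ ∘ orig) (constForm (lookup σ i) (f v)) ∎
    where open ≡-Reasoning

  extend : Vec Tri m → (Fin n → Bool) → GVar n m → Bool
  extend σ s (orig v) = s v
  extend σ s (kv i)   = proj₁ (encode (lookup σ i))
  extend σ s (ov i)   = proj₂ (encode (lookup σ i))

  restrict : (GVar n m → Bool) → Vec Tri m
  restrict τ = tabulate λ i → decode (τ (kv i)) (τ (ov i))

  fixedPoint-extend : ∀ {σ s} → FixedPoint (perturb x f σ) s → FixedPoint g (extend σ s)
  fixedPoint-extend {σ} fixed (orig v) = trans (eval-transform (sym ∘ decode-encode ∘ lookup σ) v) (fixed v)
  fixedPoint-extend     fixed (kv i)   = refl
  fixedPoint-extend {σ} fixed (ov i)   = encode-stable (lookup σ i)

  fixedPoint-restrict : ∀ {τ} → FixedPoint g τ → FixedPoint (perturb x f (restrict τ)) (τ ∘ orig)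
  fixedPoint-restrict {τ} fixed v = trans (sym (eval-transform (lookup∘tabulate _) v)) (fixed (orig v))

  satPheno-lift : ∀ {τ} β → SatPheno (τ ∘ orig) β ⇔ Satisfies τ (liftPheno {n} {m} β)
  satPheno-lift β = mk⇔ (to β) (from β)
    where
    to : ∀ {τ} β → SatPheno (τ ∘ orig) β → Satisfies τ (liftPheno {n} {m} β)
    to []      []       = []
    to (_ ∷ β) (e ∷ es) = e ∷ to β es
    from : ∀ {τ} β → Satisfies τ (liftPheno {n} {m} β) → SatPheno (τ ∘ orig) β
    from []      []       = []
    from (_ ∷ β) (e ∷ es) = e ∷ from β es

  encodeΩ : Vec Tri m → OmegaSub m
  encodeΩ σ = tabulate (quad ∘ lookup σ)

  encodeΩ-injective : Injective _≡_ _≡_ encodeΩ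
  encodeΩ-injective {σ} {σ′} e≡ = begin
    σ                    ≡⟨ tabulate∘lookup σ ⟨
    tabulate (lookup σ)  ≡⟨ tabulate-cong (λ i → quad-injective (lookup-encodeΩ i)) ⟩
    tabulate (lookup σ′) ≡⟨ tabulate∘lookup σ′ ⟩
    σ′                   ∎
    where
    open ≡-Reasoning
    lookup-encodeΩ : ∀ i → quad (lookup σ i) ≡ quad (lookup σ′ i)
    lookup-encodeΩ i = trans (sym (lookup∘tabulate _ i)) (trans (cong (λ w → lookup w i) e≡) (lookup∘tabulate _ i))

  projΩ-restrict : ∀ {τ M} → FixedPoint g τ → Represents τ M → projΩ M ≡ encodeΩ (restrict τ)
  projΩ-restrict {τ} {M} fixed rep = tabulate-cong λ i →
    begin
      (M (pA (kv i)) , M (nA (kv i)) , M (pA (ov i)) , M (nA (ov i)))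
        ≡⟨ cong₂ _,_ (proj₁ (rep (kv i)))
             (cong₂ _,_ (proj₂ (rep (kv i))) (cong₂ _,_ (proj₁ (rep (ov i))) (proj₂ (rep (ov i))))) ⟩
      (τ (kv i) , not (τ (kv i)) , τ (ov i) , not (τ (ov i)))
        ≡⟨ cong (λ (k , o) → k , not k , o , not o) (sym (encode-decode (τ (kv i)) (τ (ov i)) (fixed (ov i)))) ⟩
      quad (decode (τ (kv i)) (τ (ov i)))
        ≡⟨ cong quad (lookup∘tabulate _ i) ⟨
      quad (lookup (restrict τ) i) ∎
    where open ≡-Reasoning

  allGVar-complete : ∀ w → w ∈ allGVar n m
  allGVar-complete (orig v) = ∈-++⁺ˡ (∈-map⁺ orig (∈-allFin v))
  allGVar-complete (kv i)   = ∈-++⁺ʳ (map orig (allFin n)) (∈-++⁺ˡ (∈-map⁺ kv (∈-allFin i)))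
  allGVar-complete (ov i)   = ∈-++⁺ʳ (map orig (allFin n)) (∈-++⁺ʳ (map kv (allFin m)) (∈-map⁺ ov (∈-allFin i)))

  module _ (β : Phenotype n) where
    open AnswerSets g (allGVar n m) allGVar-complete (liftPheno β)

    Perturbed : Vec Tri m → Set
    Perturbed σ = ∃ λ s → FixedPoint (perturb x f σ) s × SatPheno s β

    Projected : OmegaSub m → Set
    Projected S = ∃ λ M → AnswerSet (ASPprog x f β) M × projΩ M ≡ S

    perturbed? : Decidable Perturbed
    perturbed? σ = ∃-state? (λ s≗s′ (fixed , sat) → fixedPoint-cong (perturb x f σ) s≗s′ fixed , satPheno-cong β s≗s′ sat)
                            (λ s → fixedPoint? (perturb x f σ) s ×-dec satPheno? s β)

    projected⇔ : ∀ S → Projected S ⇔ ∃ λ σ → Perturbed σ × S ≡ encodeΩ σ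
    projected⇔ S = mk⇔ to from
      where
      to : Projected S → ∃ λ σ → Perturbed σ × S ≡ encodeΩ σ
      to (M , answer , refl) =
        let fixed , sat , rep = answerSet⇒ answer
        in restrict (M ∘ pA) , (M ∘ pA ∘ orig , fixedPoint-restrict fixed , Equivalence.from (satPheno-lift β) sat)
           , projΩ-restrict {M = M} fixed rep
      from : (∃ λ σ → Perturbed σ × S ≡ encodeΩ σ) → Projected S
      from (σ , (s , fixed , sat) , refl) =
        canonical (extend σ s) , canonical-answerSet (fixedPoint-extend fixed) (Equivalence.to (satPheno-lift β) sat) , refl

theorem4 : (n m : ℕ) (x : Fin m → Fin n) → Injective _≡_ _≡_ x →
    (f : BN (Fin n)) (β : Phenotype n) →
    ∃[ k ] ( Card (λ (σ : Vec Tri m) →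
                     ∃ λ (s : Fin n → Bool) → FixedPoint (perturb x f σ) s × SatPheno s β) k
           × Card (λ (S : OmegaSub m) →
                     ∃ λ (M : Interp (Atom (GVar n m))) → AnswerSet (ASPprog x f β) M × projΩ M ≡ S) k )
theorem4 n m x _ f β =
  let k , card = card-of-enumeration (vectors (𝟘 ∷ 𝟙 ∷ ⋆ ∷ []) m) (∈-vectors ∈-tris) (≡-dec _≟ᵗ_) (perturbed? β)
  in k , card , card-image encodeΩ encodeΩ-injective (projected⇔ β) card
  where open Perturbation x f
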